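{- Every 1-nested (and hence every level-1) evolutionary network without tree nodes of out-degree 1 is tree-child, i.e., every internal node has at least one child that is a tree node.
   Context: An evolutionary network is a rooted directed acyclic graph whose leaves are bijectively labeled by a set of taxa. A tree node is a node of in-degree at most 1 (including the root); a hybrid node is a node of in-degree at least 2. A reticulation cycle for a hybrid node $h$ is a pair of distinct non-trivial directed paths with a common origin (the split node), both ending in $h$, that have no intermediate (non-endpoint) nodes in common; its intermediate nodes are those of the two paths. A network is 1-nested when every pair of reticulation cycles with different ends have disjoint sets of intermediate nodes. A subgraph is biconnected if it is biconnected in the underlying undirected graph; a network is level-1 when no biconnected subgraph contains more than one hybrid node. -}

module Defs where

open import Data.Bool using (Bool; true)
open import Data.Nat using (ℕ; zero; suc; _≤_; _≥_)
open import Data.Fin using (Fin)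
open import Data.List using (List; []; _∷_; _++_; length; filterᵇ; allFin)
open import Data.List.Membership.Propositional using (_∈_; _∉_)
open import Data.Product using (Σ; ∃; _×_)
open import Relation.Binary.PropositionalEquality using (_≡_; _≢_)
open import Relation.Nullary using (¬_)

-- A (simple) directed graph on the node set Fin n, given by a Boolean
-- adjacency function: E u v ≡ true  iff there is an arc u → v.
Graph : ℕ → Set
Graph n = Fin n → Fin n → Bool

module _ {n : ℕ} (E : Graph n) where

  indeg : Fin n → ℕ
  indeg v = length (filterᵇ (λ u → E u v) (allFin n))

  outdeg : Fin n → ℕ
  outdeg u = length (filterᵇ (λ v → E u v) (allFin n))

  -- tree node: in-degree at most 1 (includes the root)
  IsTreeNode : Fin n → Set
  IsTreeNode v = indeg v ≤ 1

  IsHybrid : Fin n → Set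
  IsHybrid v = indeg v ≥ 2

  IsLeaf : Fin n → Set
  IsLeaf v = outdeg v ≡ 0

  IsInternal : Fin n → Set
  IsInternal v = outdeg v ≥ 1

  -- Chain s is t : the node sequence s , is , t is a directed path
  -- with at least one arc; `is` is the list of its intermediate nodes.
  Chain : Fin n → List (Fin n) → Fin n → Set
  Chain s []       t = E s t ≡ true
  Chain s (x ∷ xs) t = (E s x ≡ true) × Chain x xs t

  Acyclic : Set
  Acyclic = ∀ v (is : List (Fin n)) → ¬ Chain v is v

  Rooted : Set
  Rooted = Σ (Fin n) λ r → ∀ v → (indeg v ≡ 0 → v ≡ r) × (v ≡ r → indeg v ≡ 0)

  record ReticulationCycle : Set where
    field
      split   : Fin n
      hyb     : Fin n
      hybrid  : IsHybrid hyb
      path₁   : List (Fin n)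
      path₂   : List (Fin n)
      chain₁  : Chain split path₁ hyb
      chain₂  : Chain split path₂ hyb
      distinct : path₁ ≢ path₂
      disjoint : ∀ x → x ∈ path₁ → x ∉ path₂

    intermediate : List (Fin n)
    intermediate = path₁ ++ path₂

  open ReticulationCycle

  OneNested : Set
  OneNested = (C D : ReticulationCycle) → hyb C ≢ hyb D →
              ∀ x → x ∈ intermediate C → x ∉ intermediate D

  NoElementaryTreeNodes : Set
  NoElementaryTreeNodes = ∀ v → IsTreeNode v → outdeg v ≢ 1

  TreeChild : Set
  TreeChild = ∀ v → IsInternal v → ∃ λ c → (E v c ≡ true) × IsTreeNode c

record EvolutionaryNetwork (n m : ℕ) : Set where
  field
    arcs     : Graph n
    acyclic  : Acyclic arcs
    rooted   : Rooted arcs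
    label    : Fin m → Fin n
    label-injective : ∀ x y → label x ≡ label y → x ≡ y
    label-leaf      : ∀ x → IsLeaf arcs (label x)
    label-onto      : ∀ v → IsLeaf arcs v → ∃ λ x → label x ≡ v

module Submission where

-- Let v be an internal node all of whose children are hybrid; we show that
-- this contradicts 1-nestedness (given that there are no elementary tree
-- nodes), so every internal node has a tree child.
--
-- The central construction, cycleThrough, works in an arbitrary graph: given
-- a path Q to a parent b of a hybrid node w, and a path that reaches a node y
-- off Q and then continues, still off Q, to another parent a of w, cutting
-- the second path at its last node on Q and closing up along Q yields a
-- reticulation cycle for w through y.  The paths it needs come from the root:
-- in a finite acyclic graph the parent relation is well founded, so every node
-- is reached from the root, and, when all children of v are hybrid, every
-- node other than v is reached from the root avoiding v.
--  * If v has two children h₁ ≠ h₂, the cycles for h₁ and for h₂ through v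
--    share the intermediate node v.
--  * Otherwise v has a single child h and, not being an elementary tree node,
--    is hybrid.  Fix a path B from the root to a second parent u of h that
--    avoids v.  A parent of v off B lies on a cycle for h and, paired with
--    another parent of v, on a cycle for v; two parents of v on B yield a cycle
--    for h and a cycle for v through the later of the two.
-- Either way two cycles for distinct hybrid nodes share a node.

open import Defs
open import Data.Bool using (true)
open import Data.Bool.Properties using (T-≡) renaming (_≟_ to _≟ᵇ_)
open import Data.Empty using (⊥; ⊥-elim)
open import Data.Fin using (Fin; _≟_)
open import Data.Fin.Properties using (pigeonhole; any?) renaming (<-irrefl to <-irreflᶠ)
open import Data.List using (List; []; _∷_; _++_; [_]; length; filterᵇ; allFin; lookup)
open import Data.List.Properties using (length-++)
open import Data.List.Membership.Propositional using (_∈_; _∉_; lose)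
open import Data.List.Membership.Propositional.Properties using (∈-++⁺ˡ; ∈-++⁺ʳ; ∈-++⁻; ∈-filter⁻; ∈-lookup)
open import Data.List.Relation.Unary.All using (All; []; _∷_) renaming (lookup to lookupᴬ)
open import Data.List.Relation.Unary.All.Properties using (¬Any⇒All¬; All¬⇒¬Any; ++⁺)
open import Data.List.Relation.Unary.AllPairs using ([]; _∷_)
open import Data.List.Relation.Unary.Any using (Any; here; there) renaming (any? to anyᴸ?; head to firstHit)
open import Data.List.Relation.Unary.Unique.Propositional using (Unique)
open import Data.List.Relation.Unary.Unique.Propositional.Properties using (allFin⁺; filter⁺)
open import Data.Nat using (ℕ; zero; suc; _≤_; _<_; _≤?_; s≤s; s≤s⁻¹; s<s⁻¹)
open import Data.Nat.Properties using (≰⇒>; n≮0; n≢0⇒n>0; ≤-antisym; +-comm)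
open import Data.Product using (Σ; ∃; ∃₂; _×_; _,_; proj₁; proj₂)
import Data.Product as Product
open import Data.Sum using (_⊎_; inj₁; inj₂; [_,_]′)
import Data.Sum as Sum
open import Data.Unit using (⊤; tt)
open import Function using (id; _∘_)
open import Function.Bundles using (Equivalence)
open import Induction.WellFounded using (Acc; acc; WellFounded)
open import Relation.Binary.PropositionalEquality using (_≡_; _≢_; refl; sym; trans; cong; subst; ≢-sym)
open import Relation.Nullary using (¬_; yes; no)
open import Relation.Nullary.Decidable using (T?; _×-dec_)

member : ∀ {A : Set} {xs : List A} → 0 < length xs → ∃ λ x → x ∈ xs
member {xs = x ∷ _} _ = x , here refl

twoDistinct : ∀ {A : Set} {xs : List A} → Unique xs → 2 ≤ length xs →
              ∃₂ λ x y → x ≢ y × x ∈ xs × y ∈ xs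
twoDistinct {xs = []}        _                  ()
twoDistinct {xs = _ ∷ []}    _                  (s≤s ())
twoDistinct {xs = x ∷ y ∷ _} ((x≢y ∷ _) ∷ _) _ = x , y , x≢y , here refl , there (here refl)

otherThan : ∀ {n} {xs : List (Fin n)} → Unique xs → 2 ≤ length xs →
            ∀ p → ∃ λ z → z ≢ p × z ∈ xs
otherThan u two p with twoDistinct u two
... | x , y , x≢y , x∈ , y∈ with x ≟ p
...   | no x≢p   = x , x≢p , x∈
...   | yes refl = y , ≢-sym x≢y , y∈

lookup-injective : ∀ {A : Set} {xs : List A} → Unique xs →
                   ∀ i j → lookup xs i ≡ lookup xs j → i ≡ j
lookup-injective (_ ∷ _)   Fin.zero    Fin.zero    _  = refl
lookup-injective (x∉ ∷ _)  Fin.zero    (Fin.suc j) eq = ⊥-elim (lookupᴬ x∉ (∈-lookup j) eq)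
lookup-injective (x∉ ∷ _)  (Fin.suc i) Fin.zero    eq = ⊥-elim (lookupᴬ x∉ (∈-lookup i) (sym eq))
lookup-injective (_ ∷ u)   (Fin.suc i) (Fin.suc j) eq = cong Fin.suc (lookup-injective u i j eq)

uniqueLength : ∀ {n} {xs : List (Fin n)} → Unique xs → length xs ≤ n
uniqueLength {n} {xs} u with length xs ≤? n
... | yes fits    = fits
... | no tooLong with pigeonhole (≰⇒> tooLong) (lookup xs)
...   | i , j , i<j , same = ⊥-elim (<-irreflᶠ (lookup-injective u i j same) i<j)

length-snoc : ∀ {A : Set} (xs : List A) y → length (xs ++ [ y ]) ≡ suc (length xs)
length-snoc xs y = trans (length-++ xs) (+-comm (length xs) 1)

module _ {n : ℕ} (E : Graph n) where

  open ReticulationCycle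
  open import Data.List.Membership.DecPropositional (_≟_ {n}) using (_∈?_)

  parents children : Fin n → List (Fin n)
  parents  y = filterᵇ (λ u → E u y) (allFin n)
  children u = filterᵇ (λ y → E u y) (allFin n)

  parent-arc : ∀ {u y} → u ∈ parents y → E u y ≡ true
  parent-arc {y = y} m =
    Equivalence.to T-≡ (proj₂ (∈-filter⁻ (λ w → T? (E w y)) {xs = allFin n} m))

  child-arc : ∀ {u y} → y ∈ children u → E u y ≡ true
  child-arc {u = u} m =
    Equivalence.to T-≡ (proj₂ (∈-filter⁻ (λ w → T? (E u w)) {xs = allFin n} m))

  otherParent : ∀ {w} → IsHybrid E w → ∀ p → ∃ λ u → u ≢ p × E u w ≡ true
  otherParent {w} hw p with otherThan (filter⁺ (λ u → T? (E u w)) (allFin⁺ n)) hw p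
  ... | u , u≢p , u∈ = u , u≢p , parent-arc u∈

  twoParents : ∀ {w} → IsHybrid E w → ∃₂ λ a b → a ≢ b × E a w ≡ true × E b w ≡ true
  twoParents {w} hw with twoDistinct (filter⁺ (λ u → T? (E u w)) (allFin⁺ n)) hw
  ... | a , b , a≢b , a∈ , b∈ = a , b , a≢b , parent-arc a∈ , parent-arc b∈

  twoChildren : ∀ {u} → 2 ≤ outdeg E u → ∃₂ λ a b → a ≢ b × E u a ≡ true × E u b ≡ true
  twoChildren {u} two with twoDistinct (filter⁺ (λ y → T? (E u y)) (allFin⁺ n)) two
  ... | a , b , a≢b , a∈ , b∈ = a , b , a≢b , child-arc a∈ , child-arc b∈

  someChild : ∀ {u} → IsInternal E u → ∃ λ y → E u y ≡ true
  someChild internal = Product.map id child-arc (member internal)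

  -- Path x ps y: a directed path from x to y whose nodes after x are ps
  -- (so y is the last entry of ps unless the path is trivial).
  infixr 5 _◅_
  data Path (x : Fin n) : List (Fin n) → Fin n → Set where
    ε   : Path x [] x
    _◅_ : ∀ {z zs y} → E x z ≡ true → Path z zs y → Path x (z ∷ zs) y

  infixr 5 _++ᵖ_
  _++ᵖ_ : ∀ {x ps y qs z} → Path x ps y → Path y qs z → Path x (ps ++ qs) z
  ε       ++ᵖ Q = Q
  (e ◅ P) ++ᵖ Q = e ◅ (P ++ᵖ Q)

  toChain : ∀ {x ps a t} → Path x ps a → E a t ≡ true → Chain E x ps t
  toChain ε       e = e
  toChain (e′ ◅ P) e = e′ , toChain P e

  target-unique : ∀ {x ps a b} → Path x ps a → Path x ps b → a ≡ b
  target-unique ε       ε       = refl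
  target-unique (_ ◅ P) (_ ◅ Q) = target-unique P Q

  last∈ : ∀ {x z zs y} → Path x (z ∷ zs) y → y ∈ z ∷ zs
  last∈ (_ ◅ ε)         = here refl
  last∈ (_ ◅ P@(_ ◅ _)) = there (last∈ P)

  target∈ : ∀ {x ps y} → x ≢ y → Path x ps y → y ∈ ps
  target∈ x≢y ε         = ⊥-elim (x≢y refl)
  target∈ _   P@(_ ◅ _) = last∈ P

  record Split (s : Fin n) (ps : List (Fin n)) (t a : Fin n) : Set where
    field
      pre post : List (Fin n)
      upTo     : Path s pre a
      from     : Path a post t
      glue     : pre ++ post ≡ ps

    pre⊆ : ∀ {z} → z ∈ s ∷ pre → z ∈ s ∷ ps
    pre⊆ (here eq) = here eq
    pre⊆ {z} (there m) = there (subst (z ∈_) glue (∈-++⁺ˡ m))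

    post⊆ : ∀ {z} → z ∈ post → z ∈ ps
    post⊆ {z} m = subst (z ∈_) glue (∈-++⁺ʳ pre m)

  open Split

  extend : ∀ {s z zs t a} → E s z ≡ true → Split z zs t a → Split s (z ∷ zs) t a
  extend e S = record { pre = _ ∷ pre S ; post = post S ; upTo = e ◅ upTo S
                      ; from = from S ; glue = cong (_ ∷_) (glue S) }

  splitAt : ∀ {s ps t a} → Path s ps t → a ∈ s ∷ ps → Split s ps t a
  splitAt P       (here refl) = record { pre = [] ; post = _ ; upTo = ε ; from = P ; glue = refl }
  splitAt ε       (there ())
  splitAt (e ◅ P) (there m)   = extend e (splitAt P m)

  order : ∀ {s ps t a b} → Path s ps t → a ∈ s ∷ ps → b ∈ s ∷ ps → a ≢ b →
          (Σ (Split s ps t a) λ S → b ∈ post S) ⊎ (Σ (Split s ps t b) λ S → a ∈ post S)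
  order P       (here refl) (here refl) a≢b = ⊥-elim (a≢b refl)
  order P       (here refl) (there b∈) _   = inj₁ (splitAt P (here refl) , b∈)
  order P       (there a∈)  (here refl) _   = inj₂ (splitAt P (here refl) , a∈)
  order ε       (there ())  (there _)   _
  order (e ◅ P) (there a∈)  (there b∈)  a≢b =
    Sum.map (Product.map (extend e) id) (Product.map (extend e) id) (order P a∈ b∈ a≢b)

  record LastExit (L : List (Fin n)) (a : Fin n) : Set where
    field
      exit   : Fin n
      rest   : List (Fin n)
      exit∈  : exit ∈ L
      tail   : Path exit rest a
      avoids : ∀ {z} → z ∈ rest → z ∉ L

  open LastExit

  -- If the path visits L at all: should a later node still lie in L,
  -- continue from the next node; otherwise the current start is the last visit.
  lastExit : ∀ L {s ps a} → Path s ps a → Any (_∈ L) (s ∷ ps) → LastExit L a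
  lastExit L ε (here s∈L) = record { exit∈ = s∈L ; tail = ε ; avoids = λ () }
  lastExit L (_◅_ {z} {zs} e P) visits with anyᴸ? (_∈? L) (z ∷ zs)
  ... | yes later = lastExit L P later
  ... | no  never = record { exit∈ = firstHit never visits ; tail = e ◅ P
                           ; avoids = λ z∈ z∈L → never (lose z∈ z∈L) }

  CycleThrough : Fin n → Fin n → Set
  CycleThrough w y = Σ (ReticulationCycle E) λ C → hyb C ≡ w × y ∈ intermediate C

  cycleOf : ∀ {x ps a qs b w} → IsHybrid E w → Path x ps a → Path x qs b →
            E a w ≡ true → E b w ≡ true → a ≢ b → (∀ {z} → z ∈ ps → z ∉ qs) →
            ReticulationCycle E
  cycleOf {x} {ps} {a} {qs} {b} {w} hw P Q aw bw a≢b separate = record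
    { split    = x
    ; hyb      = w
    ; hybrid   = hw
    ; path₁    = ps
    ; path₂    = qs
    ; chain₁   = toChain P aw
    ; chain₂   = toChain Q bw
    ; distinct = λ ps≡qs → a≢b (target-unique P (subst (λ l → Path x l b) (sym ps≡qs) Q))
    ; disjoint = λ _ → separate
    }

  segmentCycle : ∀ {a s b w} → IsHybrid E w → E a w ≡ true → E b w ≡ true → a ≢ b →
                 Path a s b → CycleThrough w b
  segmentCycle hw aw bw a≢b P = cycleOf hw ε P aw bw a≢b (λ ()) , refl , target∈ a≢b P

  -- Cutting the path to y after its last node on Q and closing up along
  -- Q gives a reticulation cycle for w through y.
  cycleThrough : ∀ {s qs b ps y ts a w} → IsHybrid E w → E a w ≡ true → E b w ≡ true →
                 a ≢ b → Path s qs b → Path s ps y → y ∉ s ∷ qs →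
                 Path y ts a → (∀ {z} → z ∈ ts → z ∉ s ∷ qs) → CycleThrough w y
  cycleThrough {s} {qs} {y = y} {ts} hw aw bw a≢b Q R y∉Q T T∉Q =
    cycleOf hw (tail X ++ᵖ T) (from S) aw bw a≢b separate , refl , ∈-++⁺ˡ (∈-++⁺ˡ y∈rest)
    where
      X = lastExit (s ∷ qs) R (here (here refl))
      S = splitAt Q (exit∈ X)

      y∈rest : y ∈ rest X
      y∈rest = target∈ (λ exit≡y → y∉Q (subst (_∈ s ∷ qs) exit≡y (exit∈ X))) (tail X)

      separate : ∀ {z} → z ∈ rest X ++ ts → z ∉ post S
      separate z∈ z∈post with ∈-++⁻ (rest X) z∈
      ... | inj₁ z∈rest = avoids X z∈rest (there (post⊆ S z∈post))
      ... | inj₂ z∈T    = T∉Q z∈T (there (post⊆ S z∈post))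

  -- Paths from s to two distinct parents a, b of a hybrid node w give a cycle
  -- for w through a or through b: through b via the segment from a to b when
  -- a lies on the path to b, and through a by cycleThrough otherwise.
  cycleAtParents : ∀ {s ps a qs b w} → IsHybrid E w → E a w ≡ true → E b w ≡ true →
                   a ≢ b → Path s ps a → Path s qs b →
                   CycleThrough w a ⊎ CycleThrough w b
  cycleAtParents {s} {a = a} {qs} hw aw bw a≢b Ra Rb with a ∈? (s ∷ qs)
  ... | yes a∈Rb = inj₂ (segmentCycle hw aw bw a≢b (from (splitAt Rb a∈Rb)))
  ... | no  a∉Rb = inj₁ (cycleThrough hw aw bw a≢b Rb Ra a∉Rb ε (λ ()))

  noSharedNode : OneNested E → ∀ {w w′ z} → w ≢ w′ → CycleThrough w z → CycleThrough w′ z → ⊥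
  noSharedNode oneNested w≢w′ (C , refl , z∈C) (D , refl , z∈D) = oneNested C D w≢w′ _ z∈C z∈D

  module _ (acyclic : Acyclic E) where

    chainPrefix : ∀ {x is y w} → Chain E x is y → w ∈ is → ∃ λ js → Chain E x js w
    chainPrefix {is = _ ∷ _} (e , _)  (here refl) = [] , e
    chainPrefix {is = z ∷ _} (e , ch) (there w∈)  = Product.map (z ∷_) (e ,_) (chainPrefix ch w∈)

    chainUnique : ∀ {x is y} → Chain E x is y → Unique (x ∷ is)
    chainUnique {is = []}     _        = [] ∷ []
    chainUnique {x} {z ∷ zs} (e , ch) =
      ¬Any⇒All¬ (z ∷ zs) (λ x∈ → let js , c = chainPrefix (e , ch) x∈ in acyclic x js c)
      ∷ chainUnique ch

    chainSnoc : ∀ {x is u y} → Chain E x is u → E u y ≡ true → Chain E x (is ++ [ u ]) y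
    chainSnoc {is = []}    e  e′ = e , e′
    chainSnoc {is = _ ∷ _} (e , ch) e′ = e , chainSnoc ch e′

    Arc : Fin n → Fin n → Set
    Arc u y = E u y ≡ true

    accessible : ∀ k y → (∀ x is → Chain E x is y → length is < k) → Acc Arc y
    accessible zero    y bound = acc λ {u} e → ⊥-elim (n≮0 (bound u [] e))
    accessible (suc k) y bound = acc λ {u} e → accessible k u λ x is c →
      s<s⁻¹ (subst (_< suc k) (length-snoc is u) (bound x (is ++ [ u ]) (chainSnoc c e)))

    -- In a finite acyclic graph the parent relation is well founded, since
    -- chains have fewer than n intermediate nodes.
    parent-wf : WellFounded Arc
    parent-wf y = accessible n y λ _ _ c → uniqueLength (chainUnique c)

    module _ (rooted : Rooted E) where

      r : Fin n
      r = proj₁ rooted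

      hasParent : ∀ y → y ≢ r → ∃ λ u → E u y ≡ true
      hasParent y y≢r =
        Product.map id parent-arc (member (n≢0⇒n>0 (y≢r ∘ proj₁ (proj₂ rooted y))))

      rootPathWithin : (P : Fin n → Set) → (∀ y → y ≢ r → ∃ λ u → P u × E u y ≡ true) →
                       ∀ y → P y → ∃ λ ps → Path r ps y × All P (r ∷ ps)
      rootPathWithin P step y = go y (parent-wf y)
        where
          go : ∀ y → Acc Arc y → P y → ∃ λ ps → Path r ps y × All P (r ∷ ps)
          go y (acc below) Py with y ≟ r
          ... | yes refl = [] , ε , Py ∷ []
          ... | no  y≢r with step y y≢r
          ...   | u , Pu , e with go u (below e) Pu
          ...     | ps , R , inP = ps ++ [ y ] , R ++ᵖ (e ◅ ε) , ++⁺ inP (Py ∷ [])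

      rootPath : ∀ y → ∃ λ ps → Path r ps y
      rootPath y = Product.map id proj₁
        (rootPathWithin (λ _ → ⊤) (λ y y≢r → Product.map id (tt ,_) (hasParent y y≢r)) y tt)

      module _ (oneNested : OneNested E) (v : Fin n)
               (childHybrid : ∀ {c} → E v c ≡ true → IsHybrid E c) where

        -- Only hybrid nodes could have v as their sole parent, and they have
        -- another one; so every non-root node has a parent other than v.
        parentBesides : ∀ y → y ≢ r → ∃ λ u → v ≢ u × E u y ≡ true
        parentBesides y y≢r with 2 ≤? indeg E y
        ... | yes hy = Product.map id (Product.map ≢-sym id) (otherParent hy v)
        ... | no ¬hy with hasParent y y≢r
        ...   | u , uy with v ≟ u
        ...     | no  v≢u  = u , v≢u , uy
        ...     | yes refl = ⊥-elim (¬hy (childHybrid uy))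

        avoidingPath : ∀ y → v ≢ y → ∃ λ ps → Path r ps y × v ∉ r ∷ ps
        avoidingPath y v≢y =
          Product.map id (Product.map id All¬⇒¬Any) (rootPathWithin (v ≢_) parentBesides y v≢y)

        -- Each child h of v has a cycle through v: combine a root path to v
        -- with a root path avoiding v to a second parent of h.
        childCycle : ∀ {h} → E v h ≡ true → CycleThrough h v
        childCycle vh with otherParent (childHybrid vh) v
        ... | u , u≢v , uh with avoidingPath u (≢-sym u≢v)
        ...   | _ , B , v∉B =
          cycleThrough (childHybrid vh) vh uh (≢-sym u≢v) B (proj₂ (rootPath v)) v∉B ε (λ ())

        module HybridParent (hv : IsHybrid E v) {h u qs} (vh : E v h ≡ true)
                            (uh : E u h ≡ true) (u≢v : u ≢ v)
                            (B : Path r qs u) (v∉B : v ∉ r ∷ qs) where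

          h≢v : h ≢ v
          h≢v refl = acyclic v [] vh

          -- A parent p of v off B lies on the cycle for h that runs through p
          -- and v and closes along B.
          cycleOffB : ∀ {p} → E p v ≡ true → p ∉ r ∷ qs → CycleThrough h p
          cycleOffB {p} pv p∉B =
            cycleThrough (childHybrid vh) vh uh (≢-sym u≢v) B (proj₂ (rootPath p)) p∉B
                         (pv ◅ ε) λ { (here refl) → v∉B }

          noCycleOffB : ∀ {p} → E p v ≡ true → p ∉ r ∷ qs → ¬ CycleThrough v p
          noCycleOffB pv p∉B = noSharedNode oneNested h≢v (cycleOffB pv p∉B)

          parentOffB : ∀ {p p′} → p ≢ p′ → E p v ≡ true → E p′ v ≡ true → p ∉ r ∷ qs → ⊥
          parentOffB {p} {p′} p≢p′ pv p′v p∉B with p′ ∈? (r ∷ qs)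
          ... | yes p′∈B =
            noCycleOffB pv p∉B
              (cycleThrough hv pv p′v p≢p′ (upTo S) (proj₂ (rootPath p)) (p∉B ∘ pre⊆ S) ε (λ ()))
            where S = splitAt B p′∈B
          ... | no p′∉B =
            [ noCycleOffB pv p∉B , noCycleOffB p′v p′∉B ]′
              (cycleAtParents hv pv p′v p≢p′ (proj₂ (rootPath p)) (proj₂ (rootPath p′)))

          -- Two parents p, p′ of v with p′ after p on B: the segment of B from
          -- p to p′ closes a cycle for v through p′, and p → v → h together
          -- with the rest of B from p closes a cycle for h through p′.
          parentsOnB : ∀ {p p′} → p ≢ p′ → E p v ≡ true → E p′ v ≡ true →
                       (S : Split r qs u p) → p′ ∈ post S → ⊥
          parentsOnB p≢p′ pv p′v S p′∈post =
            noSharedNode oneNested h≢v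
              ( cycleOf (childHybrid vh) (pv ◅ ε) (from S) vh uh (≢-sym u≢v)
                        (λ { (here refl) v∈post → v∉B (there (post⊆ S v∈post)) })
              , refl , there p′∈post )
              (segmentCycle hv pv p′v p≢p′ (upTo (splitAt (from S) (there p′∈post))))

          contradiction : ⊥
          contradiction with twoParents hv
          ... | p , p′ , p≢p′ , pv , p′v with p ∈? (r ∷ qs) | p′ ∈? (r ∷ qs)
          ...   | no p∉B  | _         = parentOffB p≢p′ pv p′v p∉B
          ...   | yes _   | no p′∉B   = parentOffB (≢-sym p≢p′) p′v pv p′∉B
          ...   | yes p∈B | yes p′∈B with order B p∈B p′∈B p≢p′
          ...     | inj₁ (S , p′∈post) = parentsOnB p≢p′ pv p′v S p′∈post
          ...     | inj₂ (S , p∈post)  = parentsOnB (≢-sym p≢p′) p′v pv S p∈post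

        hybridWithChild : IsHybrid E v → ∀ {h} → E v h ≡ true → ⊥
        hybridWithChild hv vh with otherParent (childHybrid vh) v
        ... | u , u≢v , uh with avoidingPath u (≢-sym u≢v)
        ...   | _ , B , v∉B = HybridParent.contradiction hv vh uh u≢v B v∉B

        -- Without elementary tree nodes, v cannot be internal: two children
        -- would share v on their cycles, and a single child forces v hybrid.
        notInternal : NoElementaryTreeNodes E → ¬ IsInternal E v
        notInternal noElementary internal with 2 ≤? outdeg E v
        ... | yes two with twoChildren two
        ...   | h₁ , h₂ , h₁≢h₂ , vh₁ , vh₂ =
          noSharedNode oneNested h₁≢h₂ (childCycle vh₁) (childCycle vh₂)
        notInternal noElementary internal | no ¬two with 2 ≤? indeg E v
        ...   | yes hv  = hybridWithChild hv (proj₂ (someChild internal))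
        ...   | no ¬hv  = noElementary v (s≤s⁻¹ (≰⇒> ¬hv)) (≤-antisym (s≤s⁻¹ (≰⇒> ¬two)) internal)

treeChildOrAllHybrid : ∀ {n} (E : Graph n) v →
                       (∃ λ c → E v c ≡ true × IsTreeNode E c) ⊎ (∀ c → E v c ≡ true → IsHybrid E c)
treeChildOrAllHybrid E v with any? (λ c → (E v c ≟ᵇ true) ×-dec (indeg E c ≤? 1))
... | yes found = inj₁ found
... | no  none  = inj₂ λ c vc → ≰⇒> λ c-tree → none (c , vc , c-tree)

proposition2 : (n m : ℕ) (N : EvolutionaryNetwork n m) →
    OneNested (EvolutionaryNetwork.arcs N) →
    NoElementaryTreeNodes (EvolutionaryNetwork.arcs N) →
    TreeChild (EvolutionaryNetwork.arcs N)
proposition2 n m N oneNested noElementary v internal =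
  [ id
  , (λ allHybrid → ⊥-elim (notInternal arcs acyclic rooted oneNested v (allHybrid _)
                                       noElementary internal))
  ]′ (treeChildOrAllHybrid arcs v)
  where open EvolutionaryNetwork N
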